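{- Let $\Gamma\cup\{\varphi\}$ be a set of patterns and $\psi$ a pattern. Assume there is a $(\Gamma\cup\{\varphi\})$-proof of $\psi$ in $\mathcal{MG}^c$ containing no application of the generalization rule (from $\theta$ infer $\forall x\theta$) with a variable $x$ that occurs free in $\varphi$. Then $\Gamma\vdash_{\mathcal{MG}^c}\lfloor\varphi\rfloor\to\psi$.
   Context: Fix a countably infinite set $EVar$ of element variables and a set $\Sigma$ of constant symbols containing a distinguished "definedness symbol" $\lceil\,\rceil$. Patterns: $\varphi::= x\mid \sigma\mid \bot\mid \neg\varphi\mid \varphi\to\varphi\mid \varphi\wedge\varphi\mid\varphi\vee\varphi\mid \varphi\cdot\varphi\mid \forall x\varphi\mid\exists x\varphi$ ($\varphi\cdot\psi$ is application). Abbreviations: $\varphi\leftrightarrow\psi:=(\varphi\to\psi)\wedge(\psi\to\varphi)$, $\lceil\varphi\rceil:=\lceil\,\rceil\cdot\varphi$, $\lfloor\varphi\rfloor:=\neg\lceil\neg\varphi\rceil$, $\varphi=\psi:=\lfloor\varphi\leftrightarrow\psi\rfloor$. An occurrence of $x$ is bound if inside a subpattern $\forall x\theta$ or $\exists x\theta$, otherwise free. A $\Delta$-proof of $\psi$ is a finite sequence of patterns ending with $\psi$, each an axiom instance, an element of $\Delta$, or obtained from earlier members by a rule; $\Delta\vdash\psi$ iff such a proof exists. Proof system $\mathcal{MG}^c$. Axioms: $\varphi\vee\varphi\to\varphi$; $\varphi\to\varphi\wedge\varphi$; $\varphi\to\varphi\vee\psi$; $\varphi\wedge\psi\to\varphi$;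 $\varphi\vee\psi\to\psi\vee\varphi$; $\varphi\wedge\psi\to\psi\wedge\varphi$; $\bot\to\varphi$; $\varphi\vee\neg\varphi$; $\neg\varphi\to(\varphi\to\bot)$; $(\varphi\to\bot)\to\neg\varphi$; $\forall x(\varphi\to\psi)\to(\forall x\varphi\to\forall x\psi)$; $\varphi\to\forall x\varphi$ if $x$ does not occur in $\varphi$; $\exists x(x=y)$ for $y$ distinct from $x$; $\exists x\varphi\to\neg\forall x\neg\varphi$; $\neg\forall x\neg\varphi\to\exists x\varphi$; $(\varphi\vee\psi)\cdot\chi\to\varphi\cdot\chi\vee\psi\cdot\chi$; $\chi\cdot(\varphi\vee\psi)\to\chi\cdot\varphi\vee\chi\cdot\psi$; $(\exists x\varphi)\cdot\psi\to\exists x(\varphi\cdot\psi)$ and $\psi\cdot(\exists x\varphi)\to\exists x(\psi\cdot\varphi)$ if $x$ does not occur in $\psi$; $\lceil\varphi\rceil\cdot\psi\to\lceil\varphi\rceil$; $\psi\cdot\lceil\varphi\rceil\to\lceil\varphi\rceil$; $\lceil x\rceil$; $\varphi\to\lceil\varphi\rceil$; $\lceil\bot\rceil\to\bot$. Rules: from $\varphi$, $\varphi\to\psi$ infer $\psi$; from $\varphi\to\psi$, $\psi\to\chi$ infer $\varphi\to\chi$; from $\varphi\wedge\psi\to\chi$ infer $\varphi\to(\psi\to\chi)$; from $\varphi\to(\psi\to\chi)$ infer $\varphi\wedge\psi\to\chi$; from $\varphi\to\psi$ infer $\chi\vee\varphi\to\chi\vee\psi$; generalization: from $\varphi$ infer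 $\forall x\varphi$; from $\varphi\to\psi$ infer $\varphi\cdot\chi\to\psi\cdot\chi$ and $\chi\cdot\varphi\to\chi\cdot\psi$. -}

module Defs where

open import Data.Nat using (ℕ)
open import Data.Sum using (_⊎_)
open import Data.Unit using (⊤)
open import Relation.Nullary using (¬_)
open import Relation.Binary.PropositionalEquality using (_≡_; _≢_)

EVar : Set
EVar = ℕ

-- The development is parametric in the set Σ of constant symbols and a
-- distinguished definedness symbol ⌈⌉ ∈ Σ.
module MG (Sym : Set) (⌈⌉ : Sym) where

  infixr 4 _⇒_
  infixl 6 _∧_
  infixl 5 _∨_
  infixl 8 _·_

  data Pattern : Set where
    var  : EVar → Pattern
    sym  : Sym → Pattern
    ⊥    : Pattern
    ~_   : Pattern → Pattern
    _⇒_  : Pattern → Pattern → Pattern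
    _∧_  : Pattern → Pattern → Pattern
    _∨_  : Pattern → Pattern → Pattern
    _·_  : Pattern → Pattern → Pattern
    all  : EVar → Pattern → Pattern
    ex   : EVar → Pattern → Pattern

  _⇔_ : Pattern → Pattern → Pattern
  φ ⇔ ψ = (φ ⇒ ψ) ∧ (ψ ⇒ φ)

  ⌈_⌉ : Pattern → Pattern
  ⌈ φ ⌉ = sym ⌈⌉ · φ

  ⌊_⌋ : Pattern → Pattern
  ⌊ φ ⌋ = ~ ⌈ ~ φ ⌉

  _≐_ : Pattern → Pattern → Pattern
  φ ≐ ψ = ⌊ φ ⇔ ψ ⌋

  data Occurs (x : EVar) : Pattern → Set where
    var  : Occurs x (var x)
    neg  : ∀ {φ} → Occurs x φ → Occurs x (~ φ)
    impl : ∀ {φ ψ} → Occurs x φ → Occurs x (φ ⇒ ψ)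
    impr : ∀ {φ ψ} → Occurs x ψ → Occurs x (φ ⇒ ψ)
    andl : ∀ {φ ψ} → Occurs x φ → Occurs x (φ ∧ ψ)
    andr : ∀ {φ ψ} → Occurs x ψ → Occurs x (φ ∧ ψ)
    orl  : ∀ {φ ψ} → Occurs x φ → Occurs x (φ ∨ ψ)
    orr  : ∀ {φ ψ} → Occurs x ψ → Occurs x (φ ∨ ψ)
    appl : ∀ {φ ψ} → Occurs x φ → Occurs x (φ · ψ)
    appr : ∀ {φ ψ} → Occurs x ψ → Occurs x (φ · ψ)
    allb : ∀ {φ} → Occurs x (all x φ)
    exb  : ∀ {φ} → Occurs x (ex x φ)
    all  : ∀ {y φ} → Occurs x φ → Occurs x (all y φ)
    ex   : ∀ {y φ} → Occurs x φ → Occurs x (ex y φ)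

  data FreeIn (x : EVar) : Pattern → Set where
    var  : FreeIn x (var x)
    neg  : ∀ {φ} → FreeIn x φ → FreeIn x (~ φ)
    impl : ∀ {φ ψ} → FreeIn x φ → FreeIn x (φ ⇒ ψ)
    impr : ∀ {φ ψ} → FreeIn x ψ → FreeIn x (φ ⇒ ψ)
    andl : ∀ {φ ψ} → FreeIn x φ → FreeIn x (φ ∧ ψ)
    andr : ∀ {φ ψ} → FreeIn x ψ → FreeIn x (φ ∧ ψ)
    orl  : ∀ {φ ψ} → FreeIn x φ → FreeIn x (φ ∨ ψ)
    orr  : ∀ {φ ψ} → FreeIn x ψ → FreeIn x (φ ∨ ψ)
    appl : ∀ {φ ψ} → FreeIn x φ → FreeIn x (φ · ψ)
    appr : ∀ {φ ψ} → FreeIn x ψ → FreeIn x (φ · ψ)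
    all  : ∀ {y φ} → x ≢ y → FreeIn x φ → FreeIn x (all y φ)
    ex   : ∀ {y φ} → x ≢ y → FreeIn x φ → FreeIn x (ex y φ)

  data Axiom : Pattern → Set where
    ax-or-idem   : ∀ φ → Axiom (φ ∨ φ ⇒ φ)
    ax-and-dup   : ∀ φ → Axiom (φ ⇒ φ ∧ φ)
    ax-or-intro  : ∀ φ ψ → Axiom (φ ⇒ φ ∨ ψ)
    ax-and-elim  : ∀ φ ψ → Axiom (φ ∧ ψ ⇒ φ)
    ax-or-comm   : ∀ φ ψ → Axiom (φ ∨ ψ ⇒ ψ ∨ φ)
    ax-and-comm  : ∀ φ ψ → Axiom (φ ∧ ψ ⇒ ψ ∧ φ)
    ax-bot       : ∀ φ → Axiom (⊥ ⇒ φ)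
    ax-lem       : ∀ φ → Axiom (φ ∨ ~ φ)
    ax-neg-imp   : ∀ φ → Axiom (~ φ ⇒ (φ ⇒ ⊥))
    ax-imp-neg   : ∀ φ → Axiom ((φ ⇒ ⊥) ⇒ ~ φ)
    ax-all-k     : ∀ x φ ψ → Axiom (all x (φ ⇒ ψ) ⇒ (all x φ ⇒ all x ψ))
    ax-all-vac   : ∀ x φ → ¬ Occurs x φ → Axiom (φ ⇒ all x φ)
    ax-ex-eq     : ∀ x y → x ≢ y → Axiom (ex x (var x ≐ var y))
    ax-ex-all    : ∀ x φ → Axiom (ex x φ ⇒ ~ all x (~ φ))
    ax-all-ex    : ∀ x φ → Axiom (~ all x (~ φ) ⇒ ex x φ)
    ax-prop-orl  : ∀ φ ψ χ → Axiom ((φ ∨ ψ) · χ ⇒ φ · χ ∨ ψ · χ)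
    ax-prop-orr  : ∀ φ ψ χ → Axiom (χ · (φ ∨ ψ) ⇒ χ · φ ∨ χ · ψ)
    ax-prop-exl  : ∀ x φ ψ → ¬ Occurs x ψ → Axiom ((ex x φ) · ψ ⇒ ex x (φ · ψ))
    ax-prop-exr  : ∀ x φ ψ → ¬ Occurs x ψ → Axiom (ψ · (ex x φ) ⇒ ex x (ψ · φ))
    ax-def-appl  : ∀ φ ψ → Axiom (⌈ φ ⌉ · ψ ⇒ ⌈ φ ⌉)
    ax-def-appr  : ∀ φ ψ → Axiom (ψ · ⌈ φ ⌉ ⇒ ⌈ φ ⌉)
    ax-def-var   : ∀ x → Axiom ⌈ var x ⌉
    ax-def-intro : ∀ φ → Axiom (φ ⇒ ⌈ φ ⌉)
    ax-def-bot   : Axiom (⌈ ⊥ ⌉ ⇒ ⊥)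

  -- Δ-proofs (as derivation trees), where every application of the
  -- generalization rule with variable x requires  Gen x.
  -- A proof with no restriction is obtained with Gen = λ _ → ⊤.
  data Proof (Δ : Pattern → Set) (Gen : EVar → Set) : Pattern → Set where
    axiom   : ∀ {φ} → Axiom φ → Proof Δ Gen φ
    hyp     : ∀ {φ} → Δ φ → Proof Δ Gen φ
    mp      : ∀ {φ ψ} → Proof Δ Gen φ → Proof Δ Gen (φ ⇒ ψ) → Proof Δ Gen ψ
    syll    : ∀ {φ ψ χ} → Proof Δ Gen (φ ⇒ ψ) → Proof Δ Gen (ψ ⇒ χ) → Proof Δ Gen (φ ⇒ χ)
    exp     : ∀ {φ ψ χ} → Proof Δ Gen (φ ∧ ψ ⇒ χ) → Proof Δ Gen (φ ⇒ (ψ ⇒ χ))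
    imp     : ∀ {φ ψ χ} → Proof Δ Gen (φ ⇒ (ψ ⇒ χ)) → Proof Δ Gen (φ ∧ ψ ⇒ χ)
    or-mono : ∀ {φ ψ} χ → Proof Δ Gen (φ ⇒ ψ) → Proof Δ Gen (χ ∨ φ ⇒ χ ∨ ψ)
    gen     : ∀ {φ} x → Gen x → Proof Δ Gen φ → Proof Δ Gen (all x φ)
    framel  : ∀ {φ ψ} χ → Proof Δ Gen (φ ⇒ ψ) → Proof Δ Gen (φ · χ ⇒ ψ · χ)
    framer  : ∀ {φ ψ} χ → Proof Δ Gen (φ ⇒ ψ) → Proof Δ Gen (χ · φ ⇒ χ · ψ)

  Unrestricted : EVar → Set
  Unrestricted _ = ⊤

  _⊢_ : (Pattern → Set) → Pattern → Set
  Δ ⊢ ψ = Proof Δ Unrestricted ψ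

  _∪｛_｝ : (Pattern → Set) → Pattern → (Pattern → Set)
  (Γ ∪｛ φ ｝) χ = Γ χ ⊎ χ ≡ φ

module Submission where

open import Defs
open import Data.Empty using (⊥-elim)
open import Data.Nat using (ℕ; suc; _⊔_; _≤_; _≟_; s≤s)
open import Data.Nat.Properties using (m≤m⊔n; m≤n⊔m; ≤-refl; ≤-trans; <⇒≢; n≮n)
open import Data.Sum using (inj₁; inj₂)
open import Data.Unit using (tt)
open import Function using (_∘_)
open import Relation.Binary.PropositionalEquality using (_≢_; refl; ≢-sym)
open import Relation.Nullary using (¬_; yes; no)

-- If x is not free in φ, then ⌊φ⌋ → ∀x⌊φ⌋ is provable, so every generalization step survives
-- under the hypothesis ⌊φ⌋; all other rules are lifted under ⌊φ⌋ propositionally, and application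
-- is handled because a predicate ⌊φ⌋ can be pushed into either side of an application.
-- Since the quantifier axioms only speak about variables that do not occur at all, ⊢ θ → ∀x θ for
-- x not free in θ needs a detour: θ is provably equivalent to the pattern obtained by renaming
-- every occurrence of x, bound ones included, to a fresh variable z, and x does not occur there.

module Deduction (Sym : Set) (⌈⌉ : Sym) where
  open MG Sym ⌈⌉

  FreeIn-⌊⌋ : ∀ {x φ} → FreeIn x ⌊ φ ⌋ → FreeIn x φ
  FreeIn-⌊⌋ (neg (appl ()))
  FreeIn-⌊⌋ (neg (appr (neg f))) = f

  ¬Occurs-~ : ∀ {x φ} → ¬ Occurs x φ → ¬ Occurs x (~ φ)
  ¬Occurs-~ x∉φ (neg o) = x∉φ o

  ¬Occurs-⌊⊥⇒⊥⌋ : ∀ {y} → ¬ Occurs y ⌊ ⊥ ⇒ ⊥ ⌋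
  ¬Occurs-⌊⊥⇒⊥⌋ (neg (appl ()))
  ¬Occurs-⌊⊥⇒⊥⌋ (neg (appr (neg (impl ()))))
  ¬Occurs-⌊⊥⇒⊥⌋ (neg (appr (neg (impr ()))))

  ¬Occurs-≐ : ∀ {x y z} → y ≢ x → y ≢ z → ¬ Occurs y (var x ≐ var z)
  ¬Occurs-≐ y≢x y≢z (neg (appl ()))
  ¬Occurs-≐ y≢x y≢z (neg (appr (neg (andl (impl var))))) = y≢x refl
  ¬Occurs-≐ y≢x y≢z (neg (appr (neg (andl (impr var))))) = y≢z refl
  ¬Occurs-≐ y≢x y≢z (neg (appr (neg (andr (impl var))))) = y≢z refl
  ¬Occurs-≐ y≢x y≢z (neg (appr (neg (andr (impr var))))) = y≢x refl

  maxVar : Pattern → ℕ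
  maxVar (var y)   = y
  maxVar (sym s)   = 0
  maxVar ⊥         = 0
  maxVar (~ a)     = maxVar a
  maxVar (a ⇒ b)   = maxVar a ⊔ maxVar b
  maxVar (a ∧ b)   = maxVar a ⊔ maxVar b
  maxVar (a ∨ b)   = maxVar a ⊔ maxVar b
  maxVar (a · b)   = maxVar a ⊔ maxVar b
  maxVar (all y a) = y ⊔ maxVar a
  maxVar (ex y a)  = y ⊔ maxVar a

  Occurs⇒≤maxVar : ∀ {y} θ → Occurs y θ → y ≤ maxVar θ
  Occurs⇒≤maxVar (var y)   var      = ≤-refl
  Occurs⇒≤maxVar (~ a)     (neg o)  = Occurs⇒≤maxVar a o
  Occurs⇒≤maxVar (a ⇒ b)   (impl o) = ≤-trans (Occurs⇒≤maxVar a o) (m≤m⊔n _ _)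
  Occurs⇒≤maxVar (a ⇒ b)   (impr o) = ≤-trans (Occurs⇒≤maxVar b o) (m≤n⊔m _ _)
  Occurs⇒≤maxVar (a ∧ b)   (andl o) = ≤-trans (Occurs⇒≤maxVar a o) (m≤m⊔n _ _)
  Occurs⇒≤maxVar (a ∧ b)   (andr o) = ≤-trans (Occurs⇒≤maxVar b o) (m≤n⊔m _ _)
  Occurs⇒≤maxVar (a ∨ b)   (orl o)  = ≤-trans (Occurs⇒≤maxVar a o) (m≤m⊔n _ _)
  Occurs⇒≤maxVar (a ∨ b)   (orr o)  = ≤-trans (Occurs⇒≤maxVar b o) (m≤n⊔m _ _)
  Occurs⇒≤maxVar (a · b)   (appl o) = ≤-trans (Occurs⇒≤maxVar a o) (m≤m⊔n _ _)
  Occurs⇒≤maxVar (a · b)   (appr o) = ≤-trans (Occurs⇒≤maxVar b o) (m≤n⊔m _ _)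
  Occurs⇒≤maxVar (all y a) allb     = m≤m⊔n _ _
  Occurs⇒≤maxVar (all y a) (all o)  = ≤-trans (Occurs⇒≤maxVar a o) (m≤n⊔m _ _)
  Occurs⇒≤maxVar (ex y a)  exb      = m≤m⊔n _ _
  Occurs⇒≤maxVar (ex y a)  (ex o)   = ≤-trans (Occurs⇒≤maxVar a o) (m≤n⊔m _ _)

  fresh : EVar → Pattern → EVar
  fresh x θ = suc (x ⊔ maxVar θ)

  fresh-≢ : ∀ x θ → x ≢ fresh x θ
  fresh-≢ x θ = <⇒≢ (s≤s (m≤m⊔n x (maxVar θ)))

  fresh-¬Occurs : ∀ x θ → ¬ Occurs (fresh x θ) θ
  fresh-¬Occurs x θ o = n≮n _ (s≤s (≤-trans (Occurs⇒≤maxVar θ o) (m≤n⊔m x (maxVar θ))))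

  renameVar : EVar → EVar → EVar → EVar
  renameVar x z y with y ≟ x
  ... | yes _ = z
  ... | no _  = y

  rename : EVar → EVar → Pattern → Pattern
  rename x z (var y)   = var (renameVar x z y)
  rename x z (sym s)   = sym s
  rename x z ⊥         = ⊥
  rename x z (~ a)     = ~ rename x z a
  rename x z (a ⇒ b)   = rename x z a ⇒ rename x z b
  rename x z (a ∧ b)   = rename x z a ∧ rename x z b
  rename x z (a ∨ b)   = rename x z a ∨ rename x z b
  rename x z (a · b)   = rename x z a · rename x z b
  rename x z (all y a) = all (renameVar x z y) (rename x z a)
  rename x z (ex y a)  = ex (renameVar x z y) (rename x z a)

  rename-¬Occurs : ∀ {x z} → x ≢ z → ∀ θ → ¬ Occurs x (rename x z θ)
  rename-¬Occurs {x} x≢z (var y) o with y ≟ x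
  rename-¬Occurs x≢z (var y) var | yes _   = x≢z refl
  rename-¬Occurs x≢z (var y) var | no y≢x  = y≢x refl
  rename-¬Occurs x≢z (~ a)   (neg o)  = rename-¬Occurs x≢z a o
  rename-¬Occurs x≢z (a ⇒ b) (impl o) = rename-¬Occurs x≢z a o
  rename-¬Occurs x≢z (a ⇒ b) (impr o) = rename-¬Occurs x≢z b o
  rename-¬Occurs x≢z (a ∧ b) (andl o) = rename-¬Occurs x≢z a o
  rename-¬Occurs x≢z (a ∧ b) (andr o) = rename-¬Occurs x≢z b o
  rename-¬Occurs x≢z (a ∨ b) (orl o)  = rename-¬Occurs x≢z a o
  rename-¬Occurs x≢z (a ∨ b) (orr o)  = rename-¬Occurs x≢z b o
  rename-¬Occurs x≢z (a · b) (appl o) = rename-¬Occurs x≢z a o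
  rename-¬Occurs x≢z (a · b) (appr o) = rename-¬Occurs x≢z b o
  rename-¬Occurs {x} x≢z (all y a) o with y ≟ x
  rename-¬Occurs x≢z (all y a) allb    | yes _  = x≢z refl
  rename-¬Occurs x≢z (all y a) allb    | no y≢x = y≢x refl
  rename-¬Occurs x≢z (all y a) (all o) | _      = rename-¬Occurs x≢z a o
  rename-¬Occurs {x} x≢z (ex y a) o with y ≟ x
  rename-¬Occurs x≢z (ex y a) exb     | yes _  = x≢z refl
  rename-¬Occurs x≢z (ex y a) exb     | no y≢x = y≢x refl
  rename-¬Occurs x≢z (ex y a) (ex o)  | _      = rename-¬Occurs x≢z a o

  module Derivable (Γ : Pattern → Set) where

    infix 2 ⊢_

    ⊢_ : Pattern → Set
    ⊢ a = Γ ⊢ a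

    ⇒-refl : ∀ a → ⊢ a ⇒ a
    ⇒-refl a = syll (axiom (ax-and-dup a)) (axiom (ax-and-elim a a))

    weaken : ∀ {a} c → ⊢ a → ⊢ c ⇒ a
    weaken {a} c p = mp p (exp (axiom (ax-and-elim a c)))

    ∧-elimˡ : ∀ {a b} → ⊢ a ∧ b ⇒ a
    ∧-elimˡ {a} {b} = axiom (ax-and-elim a b)

    ∧-comm : ∀ {a b} → ⊢ a ∧ b ⇒ b ∧ a
    ∧-comm {a} {b} = axiom (ax-and-comm a b)

    ∧-elimʳ : ∀ {a b} → ⊢ a ∧ b ⇒ b
    ∧-elimʳ = syll ∧-comm ∧-elimˡ

    ∧-intro : ∀ a b → ⊢ a ⇒ b ⇒ a ∧ b
    ∧-intro a b = exp (⇒-refl (a ∧ b))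

    ∧-monoˡ : ∀ {a a' b} → ⊢ a ⇒ a' → ⊢ a ∧ b ⇒ a' ∧ b
    ∧-monoˡ {a' = a'} {b} p = imp (syll p (∧-intro a' b))

    ∧-monoʳ : ∀ {a b b'} → ⊢ b ⇒ b' → ⊢ a ∧ b ⇒ a ∧ b'
    ∧-monoʳ p = syll ∧-comm (syll (∧-monoˡ p) ∧-comm)

    ∨-introˡ : ∀ {a b} → ⊢ a ⇒ a ∨ b
    ∨-introˡ {a} {b} = axiom (ax-or-intro a b)

    ∨-introʳ : ∀ {a b} → ⊢ b ⇒ a ∨ b
    ∨-introʳ {a} {b} = syll (axiom (ax-or-intro b a)) (axiom (ax-or-comm b a))

    ∨-elim : ∀ {a b c} → ⊢ a ⇒ c → ⊢ b ⇒ c → ⊢ a ∨ b ⇒ c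
    ∨-elim {a} {b} {c} p q =
      syll (or-mono a q) (syll (axiom (ax-or-comm a c)) (syll (or-mono c p) (axiom (ax-or-idem c))))

    pair : ∀ {C a b} → ⊢ C ⇒ a → ⊢ C ⇒ b → ⊢ C ⇒ a ∧ b
    pair {C} p q = syll (axiom (ax-and-dup C)) (syll (∧-monoˡ p) (∧-monoʳ q))

    ctx-mp : ∀ {C a b} → ⊢ C ⇒ a ⇒ b → ⊢ C ⇒ a → ⊢ C ⇒ b
    ctx-mp {a = a} {b} p q = syll (pair p q) (imp (⇒-refl (a ⇒ b)))

    ctx-weaken : ∀ {C a b} → ⊢ C ⇒ b → ⊢ C ∧ a ⇒ b
    ctx-weaken p = syll ∧-elimˡ p

    ctx-⇒-refl : ∀ {C} a → ⊢ C ⇒ a ⇒ a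
    ctx-⇒-refl a = weaken _ (⇒-refl a)

    ctx-∨-elim : ∀ {C a b c} → ⊢ C ⇒ a ∨ b → ⊢ C ∧ a ⇒ c → ⊢ C ∧ b ⇒ c → ⊢ C ⇒ c
    ctx-∨-elim {C} r p q =
      ctx-mp (syll r (∨-elim (exp (syll ∧-comm p)) (exp (syll ∧-comm q)))) (⇒-refl C)

    ctx-¬-elim : ∀ {C a} → ⊢ C ⇒ ~ a → ⊢ C ⇒ a → ⊢ C ⇒ ⊥
    ctx-¬-elim {a = a} p q = ctx-mp (syll p (axiom (ax-neg-imp a))) q

    ctx-¬-intro : ∀ {C a} → ⊢ C ∧ a ⇒ ⊥ → ⊢ C ⇒ ~ a
    ctx-¬-intro {a = a} p = syll (exp p) (axiom (ax-imp-neg a))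

    ctx-⊥-elim : ∀ {C a} → ⊢ C ⇒ ⊥ → ⊢ C ⇒ a
    ctx-⊥-elim {a = a} p = syll p (axiom (ax-bot a))

    ctx-¬¬-elim : ∀ {C a} → ⊢ C ⇒ ~ ~ a → ⊢ C ⇒ a
    ctx-¬¬-elim {C} {a} p =
      ctx-∨-elim (weaken C (axiom (ax-lem a))) ∧-elimʳ (ctx-⊥-elim (ctx-¬-elim (ctx-weaken p) ∧-elimʳ))

    ¬¬-intro : ∀ {a} → ⊢ a ⇒ ~ ~ a
    ¬¬-intro = ctx-¬-intro (ctx-¬-elim ∧-elimʳ ∧-elimˡ)

    contraposition : ∀ {a b} → ⊢ a ⇒ b → ⊢ ~ b ⇒ ~ a
    contraposition p = ctx-¬-intro (ctx-¬-elim ∧-elimˡ (syll ∧-elimʳ p))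

    ctx-contraposition : ∀ {C a b} → ⊢ C ⇒ a ⇒ b → ⊢ C ⇒ ~ b ⇒ ~ a
    ctx-contraposition p =
      exp (ctx-¬-intro (ctx-¬-elim (ctx-weaken ∧-elimʳ) (ctx-mp (ctx-weaken (ctx-weaken p)) ∧-elimʳ)))

    ctx-syll : ∀ {C a b c} → ⊢ C ⇒ a ⇒ b → ⊢ C ⇒ b ⇒ c → ⊢ C ⇒ a ⇒ c
    ctx-syll p q = exp (ctx-mp (ctx-weaken q) (ctx-mp (ctx-weaken p) ∧-elimʳ))

    ctx-exp : ∀ {C a b c} → ⊢ C ⇒ a ∧ b ⇒ c → ⊢ C ⇒ a ⇒ b ⇒ c
    ctx-exp p = exp (exp (ctx-mp (ctx-weaken (ctx-weaken p)) (pair (ctx-weaken ∧-elimʳ) ∧-elimʳ)))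

    ctx-imp : ∀ {C a b c} → ⊢ C ⇒ a ⇒ b ⇒ c → ⊢ C ⇒ a ∧ b ⇒ c
    ctx-imp p = exp (ctx-mp (ctx-mp (ctx-weaken p) (syll ∧-elimʳ ∧-elimˡ)) (syll ∧-elimʳ ∧-elimʳ))

    ctx-⇒-mono : ∀ {C a a' b b'} → ⊢ C ⇒ a' ⇒ a → ⊢ C ⇒ b ⇒ b' → ⊢ C ⇒ (a ⇒ b) ⇒ (a' ⇒ b')
    ctx-⇒-mono p q = exp (ctx-syll (ctx-weaken p) (ctx-syll ∧-elimʳ (ctx-weaken q)))

    ctx-∧-mono : ∀ {C a a' b b'} → ⊢ C ⇒ a ⇒ a' → ⊢ C ⇒ b ⇒ b' → ⊢ C ⇒ a ∧ b ⇒ a' ∧ b'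
    ctx-∧-mono p q =
      exp (pair (ctx-mp (ctx-weaken p) (syll ∧-elimʳ ∧-elimˡ)) (ctx-mp (ctx-weaken q) (syll ∧-elimʳ ∧-elimʳ)))

    ctx-∨-mono : ∀ {C a a' b b'} → ⊢ C ⇒ a ⇒ a' → ⊢ C ⇒ b ⇒ b' → ⊢ C ⇒ a ∨ b ⇒ a' ∨ b'
    ctx-∨-mono p q = exp (ctx-∨-elim ∧-elimʳ (branch p ∨-introˡ) (branch q ∨-introʳ))
      where
      branch : ∀ {C a a' c d} → ⊢ C ⇒ a ⇒ a' → ⊢ a' ⇒ d → ⊢ (C ∧ c) ∧ a ⇒ d
      branch p i = syll (ctx-mp (ctx-weaken (ctx-weaken p)) ∧-elimʳ) i

    ⌊⌋-elim : ∀ {a} → ⊢ ⌊ a ⌋ ⇒ a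
    ⌊⌋-elim {a} = ctx-¬¬-elim (contraposition (axiom (ax-def-intro (~ a))))

    ⌊⌋-intro : ∀ {a} → ⊢ a → ⊢ ⌊ a ⌋
    ⌊⌋-intro {a} p = mp ⌈¬a⌉⇒⊥ (axiom (ax-imp-neg ⌈ ~ a ⌉))
      where
      ⌈¬a⌉⇒⊥ : ⊢ ⌈ ~ a ⌉ ⇒ ⊥
      ⌈¬a⌉⇒⊥ = syll (framer (sym ⌈⌉) (ctx-¬-elim (⇒-refl (~ a)) (weaken (~ a) p))) (axiom ax-def-bot)

    ≐-sym : ∀ {a b} → ⊢ a ≐ b ⇒ b ≐ a
    ≐-sym = contraposition (framer (sym ⌈⌉) (contraposition ∧-comm))

    split-on : ∀ F a → ⊢ a ⇒ (F ∧ a) ∨ (~ F ∧ a)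
    split-on F a = ctx-∨-elim (weaken a (axiom (ax-lem F))) (syll ∧-comm ∨-introˡ) (syll ∧-comm ∨-introʳ)

    ¬⌊⌋⇒⌈¬⌉ : ∀ {Q} → ⊢ ~ ⌊ Q ⌋ ⇒ ⌈ ~ Q ⌉
    ¬⌊⌋⇒⌈¬⌉ = ctx-¬¬-elim (⇒-refl _)

    -- Split the frame on ⌊Q⌋ ∨ ¬⌊Q⌋; in the second case ¬⌊Q⌋ = ⌈¬Q⌉ absorbs the application.
    push-⌊⌋ˡ : ∀ {Q a c} → ⊢ ⌊ Q ⌋ ∧ a · c ⇒ (⌊ Q ⌋ ∧ a) · c
    push-⌊⌋ˡ {Q} {a} {c} =
      ctx-∨-elim (syll ∧-elimʳ (syll (framel c (split-on ⌊ Q ⌋ a)) (axiom (ax-prop-orl _ _ c))))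
                 ∧-elimʳ
                 (ctx-⊥-elim (ctx-¬-elim (syll ∧-elimʳ absorbed) (ctx-weaken ∧-elimˡ)))
      where
      absorbed : ⊢ (~ ⌊ Q ⌋ ∧ a) · c ⇒ ~ ⌊ Q ⌋
      absorbed = syll (framel c (syll ∧-elimˡ ¬⌊⌋⇒⌈¬⌉)) (syll (axiom (ax-def-appl (~ Q) c)) ¬¬-intro)

    push-⌊⌋ʳ : ∀ {Q a c} → ⊢ ⌊ Q ⌋ ∧ c · a ⇒ c · (⌊ Q ⌋ ∧ a)
    push-⌊⌋ʳ {Q} {a} {c} =
      ctx-∨-elim (syll ∧-elimʳ (syll (framer c (split-on ⌊ Q ⌋ a)) (axiom (ax-prop-orr _ _ c))))
                 ∧-elimʳ
                 (ctx-⊥-elim (ctx-¬-elim (syll ∧-elimʳ absorbed) (ctx-weaken ∧-elimˡ)))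
      where
      absorbed : ⊢ c · (~ ⌊ Q ⌋ ∧ a) ⇒ ~ ⌊ Q ⌋
      absorbed = syll (framer c (syll ∧-elimˡ ¬⌊⌋⇒⌈¬⌉)) (syll (axiom (ax-def-appr (~ Q) c)) ¬¬-intro)

    ctx-·-mono : ∀ {Q a a' b b'} → ⊢ ⌊ Q ⌋ ⇒ a ⇒ a' → ⊢ ⌊ Q ⌋ ⇒ b ⇒ b' → ⊢ ⌊ Q ⌋ ⇒ a · b ⇒ a' · b'
    ctx-·-mono {a' = a'} {b} p q =
      exp (syll (pair ∧-elimˡ (syll push-⌊⌋ˡ (framel b (imp p)))) (syll push-⌊⌋ʳ (framer a' (imp q))))

    all-mono : ∀ {x a b} → ⊢ a ⇒ b → ⊢ all x a ⇒ all x b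
    all-mono {x} {a} {b} p = mp (gen x tt p) (axiom (ax-all-k x a b))

    ex-mono : ∀ {x a b} → ⊢ a ⇒ b → ⊢ ex x a ⇒ ex x b
    ex-mono {x} {a} {b} p =
      syll (axiom (ax-ex-all x a))
           (syll (contraposition (all-mono (contraposition p))) (axiom (ax-all-ex x b)))

    all-ex-K : ∀ x a b → ⊢ all x (a ⇒ b) ⇒ ex x a ⇒ ex x b
    all-ex-K x a b =
      ctx-syll (weaken _ (axiom (ax-ex-all x a)))
        (ctx-syll (ctx-contraposition all¬b⇒all¬a) (weaken _ (axiom (ax-all-ex x b))))
      where
      all¬b⇒all¬a : ⊢ all x (a ⇒ b) ⇒ all x (~ b) ⇒ all x (~ a)
      all¬b⇒all¬a = syll (all-mono (ctx-contraposition (⇒-refl (a ⇒ b)))) (axiom (ax-all-k x (~ b) (~ a)))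

    all∧ex⇒ex∧ : ∀ x a b → ⊢ all x a ∧ ex x b ⇒ ex x (a ∧ b)
    all∧ex⇒ex∧ x a b = imp (syll (all-mono (∧-intro a b)) (all-ex-K x b (a ∧ b)))

    ex-vac : ∀ {x a} → ¬ Occurs x a → ⊢ ex x a ⇒ a
    ex-vac {x} {a} x∉a =
      syll (axiom (ax-ex-all x a)) (ctx-¬¬-elim (contraposition (axiom (ax-all-vac x (~ a) (¬Occurs-~ x∉a)))))

    ctx-all-mono : ∀ {C a a'} y → ¬ Occurs y C → ⊢ C ⇒ a ⇒ a' → ⊢ C ⇒ all y a ⇒ all y a'
    ctx-all-mono {C} {a} {a'} y y∉C p =
      syll (axiom (ax-all-vac y C y∉C)) (syll (all-mono p) (axiom (ax-all-k y a a')))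

    ctx-ex-mono : ∀ {C a a'} y → ¬ Occurs y C → ⊢ C ⇒ a ⇒ a' → ⊢ C ⇒ ex y a ⇒ ex y a'
    ctx-ex-mono {C} {a} {a'} y y∉C p =
      syll (axiom (ax-all-vac y C y∉C)) (syll (all-mono p) (all-ex-K y a a'))

    ⇔-to : ∀ {C a b} → ⊢ C ⇒ a ⇔ b → ⊢ C ⇒ a ⇒ b
    ⇔-to p = syll p ∧-elimˡ

    ⇔-from : ∀ {C a b} → ⊢ C ⇒ a ⇔ b → ⊢ C ⇒ b ⇒ a
    ⇔-from p = syll p ∧-elimʳ

    ⇔-refl : ∀ {C} a → ⊢ C ⇒ a ⇔ a
    ⇔-refl a = pair (ctx-⇒-refl a) (ctx-⇒-refl a)

    ⇔-cong-~ : ∀ {C a a'} → ⊢ C ⇒ a ⇔ a' → ⊢ C ⇒ (~ a) ⇔ (~ a')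
    ⇔-cong-~ p = pair (ctx-contraposition (⇔-from p)) (ctx-contraposition (⇔-to p))

    ⇔-cong-⇒ : ∀ {C a a' b b'} → ⊢ C ⇒ a ⇔ a' → ⊢ C ⇒ b ⇔ b' → ⊢ C ⇒ (a ⇒ b) ⇔ (a' ⇒ b')
    ⇔-cong-⇒ p q = pair (ctx-⇒-mono (⇔-from p) (⇔-to q)) (ctx-⇒-mono (⇔-to p) (⇔-from q))

    ⇔-cong-∧ : ∀ {C a a' b b'} → ⊢ C ⇒ a ⇔ a' → ⊢ C ⇒ b ⇔ b' → ⊢ C ⇒ (a ∧ b) ⇔ (a' ∧ b')
    ⇔-cong-∧ p q = pair (ctx-∧-mono (⇔-to p) (⇔-to q)) (ctx-∧-mono (⇔-from p) (⇔-from q))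

    ⇔-cong-∨ : ∀ {C a a' b b'} → ⊢ C ⇒ a ⇔ a' → ⊢ C ⇒ b ⇔ b' → ⊢ C ⇒ (a ∨ b) ⇔ (a' ∨ b')
    ⇔-cong-∨ p q = pair (ctx-∨-mono (⇔-to p) (⇔-to q)) (ctx-∨-mono (⇔-from p) (⇔-from q))

    ⇔-cong-· : ∀ {Q a a' b b'} → ⊢ ⌊ Q ⌋ ⇒ a ⇔ a' → ⊢ ⌊ Q ⌋ ⇒ b ⇔ b' → ⊢ ⌊ Q ⌋ ⇒ (a · b) ⇔ (a' · b')
    ⇔-cong-· p q = pair (ctx-·-mono (⇔-to p) (⇔-to q)) (ctx-·-mono (⇔-from p) (⇔-from q))

    ⇔-cong-all : ∀ {C a a'} y → ¬ Occurs y C → ⊢ C ⇒ a ⇔ a' → ⊢ C ⇒ (all y a) ⇔ (all y a')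
    ⇔-cong-all y y∉C p = pair (ctx-all-mono y y∉C (⇔-to p)) (ctx-all-mono y y∉C (⇔-from p))

    ⇔-cong-ex : ∀ {C a a'} y → ¬ Occurs y C → ⊢ C ⇒ a ⇔ a' → ⊢ C ⇒ (ex y a) ⇔ (ex y a')
    ⇔-cong-ex y y∉C p = pair (ctx-ex-mono y y∉C (⇔-to p)) (ctx-ex-mono y y∉C (⇔-from p))

    -- From ∀x a and ∃x (x = z) we get ∃x a', which is a' as x does not occur in a'.
    all-rename⇒ : ∀ {x z a a'} → x ≢ z → ⊢ var x ≐ var z ⇒ a ⇒ a' → ¬ Occurs z a → ¬ Occurs x a'
                → ⊢ all x a ⇒ all z a'
    all-rename⇒ {x} {z} {a} {a'} x≢z p z∉a x∉a' =
      syll (axiom (ax-all-vac z (all x a) z∉∀xa)) (all-mono instantiate)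
      where
      z∉∀xa : ¬ Occurs z (all x a)
      z∉∀xa allb    = x≢z refl
      z∉∀xa (all o) = z∉a o

      instantiate : ⊢ all x a ⇒ a'
      instantiate =
        syll (pair (⇒-refl (all x a)) (weaken _ (axiom (ax-ex-eq x z x≢z))))
             (syll (all∧ex⇒ex∧ x a _) (syll (ex-mono (syll ∧-comm (imp p))) (ex-vac x∉a')))

    ex-rename⇒ : ∀ {x z a a'} → x ≢ z → ⊢ var x ≐ var z ⇒ a ⇒ a' → ¬ Occurs z a → ¬ Occurs x a'
               → ⊢ ex x a ⇒ ex z a'
    ex-rename⇒ {x} {z} {a} {a'} x≢z p z∉a x∉a' =
      syll (axiom (ax-ex-all x a)) (syll (contraposition all¬a'⇒all¬a) (axiom (ax-all-ex z a')))
      where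
      all¬a'⇒all¬a : ⊢ all z (~ a') ⇒ all x (~ a)
      all¬a'⇒all¬a =
        all-rename⇒ (≢-sym x≢z) (syll ≐-sym (ctx-contraposition p)) (¬Occurs-~ x∉a') (¬Occurs-~ z∉a)

    all-rename : ∀ {C x z a a'} → x ≢ z → ⊢ var x ≐ var z ⇒ a ⇔ a' → ¬ Occurs z a → ¬ Occurs x a'
               → ⊢ C ⇒ (all x a) ⇔ (all z a')
    all-rename x≢z p z∉a x∉a' =
      pair (weaken _ (all-rename⇒ x≢z (⇔-to p) z∉a x∉a'))
           (weaken _ (all-rename⇒ (≢-sym x≢z) (syll ≐-sym (⇔-from p)) x∉a' z∉a))

    ex-rename : ∀ {C x z a a'} → x ≢ z → ⊢ var x ≐ var z ⇒ a ⇔ a' → ¬ Occurs z a → ¬ Occurs x a'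
              → ⊢ C ⇒ (ex x a) ⇔ (ex z a')
    ex-rename x≢z p z∉a x∉a' =
      pair (weaken _ (ex-rename⇒ x≢z (⇔-to p) z∉a x∉a'))
           (weaken _ (ex-rename⇒ (≢-sym x≢z) (syll ≐-sym (⇔-from p)) x∉a' z∉a))

    -- The context ⌊Q⌋ must provide x = z wherever x is free; a binder ∀x restarts with Q := (x ⇔ z).
    rename-⇔ : ∀ {x z Q} → x ≢ z → ∀ θ → (∀ {y} → y ≢ x → y ≢ z → ¬ Occurs y ⌊ Q ⌋) → ¬ Occurs z θ
             → (FreeIn x θ → ⊢ ⌊ Q ⌋ ⇒ var x ⇔ var z) → ⊢ ⌊ Q ⌋ ⇒ θ ⇔ rename x z θ
    rename-⇔ {x} x≢z (var y) Qv z∉θ x=z with y ≟ x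
    ... | yes refl = x=z var
    ... | no _     = ⇔-refl _
    rename-⇔ x≢z (sym s) Qv z∉θ x=z = ⇔-refl _
    rename-⇔ x≢z ⊥ Qv z∉θ x=z = ⇔-refl _
    rename-⇔ x≢z (~ a) Qv z∉θ x=z = ⇔-cong-~ (rename-⇔ x≢z a Qv (z∉θ ∘ neg) (x=z ∘ neg))
    rename-⇔ x≢z (a ⇒ b) Qv z∉θ x=z =
      ⇔-cong-⇒ (rename-⇔ x≢z a Qv (z∉θ ∘ impl) (x=z ∘ impl)) (rename-⇔ x≢z b Qv (z∉θ ∘ impr) (x=z ∘ impr))
    rename-⇔ x≢z (a ∧ b) Qv z∉θ x=z =
      ⇔-cong-∧ (rename-⇔ x≢z a Qv (z∉θ ∘ andl) (x=z ∘ andl)) (rename-⇔ x≢z b Qv (z∉θ ∘ andr) (x=z ∘ andr))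
    rename-⇔ x≢z (a ∨ b) Qv z∉θ x=z =
      ⇔-cong-∨ (rename-⇔ x≢z a Qv (z∉θ ∘ orl) (x=z ∘ orl)) (rename-⇔ x≢z b Qv (z∉θ ∘ orr) (x=z ∘ orr))
    rename-⇔ x≢z (a · b) Qv z∉θ x=z =
      ⇔-cong-· (rename-⇔ x≢z a Qv (z∉θ ∘ appl) (x=z ∘ appl)) (rename-⇔ x≢z b Qv (z∉θ ∘ appr) (x=z ∘ appr))
    rename-⇔ {x} x≢z (all y a) Qv z∉θ x=z with y ≟ x
    ... | yes refl =
      all-rename x≢z (rename-⇔ x≢z a ¬Occurs-≐ (z∉θ ∘ all) (λ _ → ⌊⌋-elim)) (z∉θ ∘ all) (rename-¬Occurs x≢z a)
    ... | no y≢x =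
      ⇔-cong-all y (Qv y≢x λ { refl → z∉θ allb }) (rename-⇔ x≢z a Qv (z∉θ ∘ all) (x=z ∘ all (≢-sym y≢x)))
    rename-⇔ {x} x≢z (ex y a) Qv z∉θ x=z with y ≟ x
    ... | yes refl =
      ex-rename x≢z (rename-⇔ x≢z a ¬Occurs-≐ (z∉θ ∘ ex) (λ _ → ⌊⌋-elim)) (z∉θ ∘ ex) (rename-¬Occurs x≢z a)
    ... | no y≢x =
      ⇔-cong-ex y (Qv y≢x λ { refl → z∉θ exb }) (rename-⇔ x≢z a Qv (z∉θ ∘ ex) (x=z ∘ ex (≢-sym y≢x)))

    rename-⇔-¬FreeIn : ∀ {x z} → x ≢ z → ∀ θ → ¬ Occurs z θ → ¬ FreeIn x θ → ⊢ θ ⇔ rename x z θ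
    rename-⇔-¬FreeIn x≢z θ z∉θ x∉θ =
      mp (⌊⌋-intro (⇒-refl ⊥)) (rename-⇔ x≢z θ (λ _ _ → ¬Occurs-⌊⊥⇒⊥⌋) z∉θ (⊥-elim ∘ x∉θ))

    all-intro-¬FreeIn : ∀ {x} θ → ¬ FreeIn x θ → ⊢ θ ⇒ all x θ
    all-intro-¬FreeIn {x} θ x∉θ =
      syll (mp θ⇔θ' ∧-elimˡ)
           (syll (axiom (ax-all-vac x _ (rename-¬Occurs x≢z θ))) (all-mono (mp θ⇔θ' ∧-elimʳ)))
      where
      x≢z : x ≢ fresh x θ
      x≢z = fresh-≢ x θ

      θ⇔θ' : ⊢ θ ⇔ rename x (fresh x θ) θ
      θ⇔θ' = rename-⇔-¬FreeIn x≢z θ (fresh-¬Occurs x θ) x∉θ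

    deduction : ∀ {φ ψ} → Proof (Γ ∪｛ φ ｝) (λ x → ¬ FreeIn x φ) ψ → ⊢ ⌊ φ ⌋ ⇒ ψ
    deduction (axiom a)            = weaken _ (axiom a)
    deduction (hyp (inj₁ γ))       = weaken _ (hyp γ)
    deduction (hyp (inj₂ refl))    = ⌊⌋-elim
    deduction (mp p q)             = ctx-mp (deduction q) (deduction p)
    deduction (syll p q)           = ctx-syll (deduction p) (deduction q)
    deduction (exp p)              = ctx-exp (deduction p)
    deduction (imp p)              = ctx-imp (deduction p)
    deduction (or-mono χ p)        = ctx-∨-mono (ctx-⇒-refl χ) (deduction p)
    deduction {φ} (gen x x∉φ p)    = syll (all-intro-¬FreeIn ⌊ φ ⌋ (x∉φ ∘ FreeIn-⌊⌋)) (all-mono (deduction p))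
    deduction (framel χ p)         = ctx-·-mono (deduction p) (ctx-⇒-refl χ)
    deduction (framer χ p)         = ctx-·-mono (ctx-⇒-refl χ) (deduction p)

mainTheorem4 : (Sym : Set) (⌈⌉ : Sym) → let open MG Sym ⌈⌉ in
    (Γ : Pattern → Set) (φ ψ : Pattern) →
    Proof (Γ ∪｛ φ ｝) (λ x → ¬ FreeIn x φ) ψ →
    Γ ⊢ (⌊ φ ⌋ ⇒ ψ)
mainTheorem4 Sym ⌈⌉ Γ φ ψ = Deduction.Derivable.deduction Sym ⌈⌉ Γ
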